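{- Let $G=(V,E)$ be a two-rooted Eulerian graph with roots $x,y$, and let $G'=\textbf{gcds}_{\{u,v\}}(G)$ for some adjacent non-root vertices $u,v$. Then $G'$ has property $a$ if and only if $G$ has property $a$.
   Context: A two-rooted graph is a finite simple undirected graph with two designated roots. A graph is Eulerian if every vertex has even degree. With $f_a(b)=1$ iff $a,b$ adjacent, $\textbf{gcds}_{\{p,q\}}(G)$ (for adjacent non-root $p,q$) is the graph on $V$ where distinct $s,t$ are adjacent iff $f_p(s)f_q(t)+f_q(s)f_p(t)+f_s(t)\equiv1\pmod 2$. A parity cut of $G$ is a partition $V=V_1\cup V_2$, $V_1\cap V_2=\emptyset$, such that every vertex (roots included) has an even number of neighbours in the part not containing it. $G$ has property $a$ if it has a parity cut $(V_1,V_2)$ with $x\in V_1$ and $y\in V_2$. -}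

module Defs where

open import Data.Nat using (ℕ)
open import Data.Nat.Divisibility using (_∣_)
open import Data.Fin using (Fin; _≟_)
open import Data.Bool using (Bool; true; false; _∧_; _xor_; not; if_then_else_)
import Data.Bool as B
open import Data.Bool.Properties using (∧-comm; xor-comm)
open import Data.List using (List; filter; length; allFin)
open import Relation.Binary.PropositionalEquality using (_≡_; _≢_; refl; sym; cong; cong₂; trans)
open import Relation.Nullary using (yes; no; ¬_)
open import Relation.Nullary.Decidable using (does)
open import Data.Product using (Σ; ∃; _×_; _,_)

record Graph (n : ℕ) : Set where
  field
    adj    : Fin n → Fin n → Bool
    symm   : ∀ a b → adj a b ≡ adj b a
    irrefl : ∀ a → adj a a ≡ false
open Graph public

countV : ∀ {n} → (Fin n → Bool) → ℕ
countV {n} P = length (filter (λ w → P w B.≟ true) (allFin n))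

Even : ℕ → Set
Even k = 2 ∣ k

degree : ∀ {n} → Graph n → Fin n → ℕ
degree G v = countV (adj G v)

Eulerian : ∀ {n} → Graph n → Set
Eulerian G = ∀ v → Even (degree G v)

gcdsAdj : ∀ {n} → Graph n → Fin n → Fin n → Fin n → Fin n → Bool
gcdsAdj G p q s t =
  if does (s ≟ t) then false
  else ((adj G p s ∧ adj G q t) xor (adj G q s ∧ adj G p t)) xor adj G s t

private
  xorsym : ∀ a b c d e → ((a ∧ b) xor (c ∧ d)) xor e ≡ ((c ∧ d) xor (a ∧ b)) xor e
  xorsym a b c d e = cong (_xor e) (xor-comm (a ∧ b) (c ∧ d))

gcdsSymm : ∀ {n} (G : Graph n) p q s t → gcdsAdj G p q s t ≡ gcdsAdj G p q t s
gcdsSymm G p q s t with s ≟ t | t ≟ s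
... | yes _ | yes _ = refl
... | yes e | no ne = Data.Empty.⊥-elim (ne (sym e))
  where import Data.Empty
... | no ne | yes e = Data.Empty.⊥-elim (ne (sym e))
  where import Data.Empty
... | no _ | no _ =
  trans (xorsym (adj G p s) (adj G q t) (adj G q s) (adj G p t) (adj G s t))
        (cong (((adj G q s ∧ adj G p t) xor (adj G p s ∧ adj G q t)) xor_) (symm G s t))
  |> λ h → trans h (cong₂ (λ a b → (a xor b) xor adj G t s) (∧-comm (adj G q s) (adj G p t)) (∧-comm (adj G p s) (adj G q t)))
  where
  _|>_ : ∀ {A B : Set} → A → (A → B) → B
  x |> f = f x

gcdsIrrefl : ∀ {n} (G : Graph n) p q s → gcdsAdj G p q s s ≡ false
gcdsIrrefl G p q s with s ≟ s
... | yes _ = refl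
... | no ne = Data.Empty.⊥-elim (ne refl)
  where import Data.Empty

gcds : ∀ {n} → Graph n → Fin n → Fin n → Graph n
gcds G p q = record
  { adj = gcdsAdj G p q ; symm = gcdsSymm G p q ; irrefl = gcdsIrrefl G p q }

-- A partition V = V₁ ∪ V₂ is encoded by side : Fin n → Bool
-- (side v = false means v ∈ V₁, side v = true means v ∈ V₂).
IsParityCut : ∀ {n} → Graph n → (Fin n → Bool) → Set
IsParityCut G side =
  ∀ v → Even (countV (λ w → adj G v w ∧ (side w xor side v)))

PropertyA : ∀ {n} → Graph n → Fin n → Fin n → Set
PropertyA G x y =
  Σ (Fin _ → Bool) λ side → IsParityCut G side × side x ≡ false × side y ≡ true

-- Over GF(2), a 0/1 labelling s of the vertices of an Eulerian graph is a
-- parity cut iff A s = 0 for the adjacency matrix A, because the number of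
-- neighbours of v across the cut is (A s)_v + s_v deg v.  The graph
-- gcds_{p,q}(G) has adjacency matrix A' = A + a_p a_qᵀ + a_q a_pᵀ, where a_p, a_q
-- are the columns of p and q, so A' s = A s + (a_q · s) a_p + (a_p · s) a_q.
-- Hence A' is again Eulerian (take s = 1), every cut of G is a cut of G',
-- and a cut s of G' is turned into a cut of G by flipping the labels of p and
-- q according to a_q · s and a_p · s.  Since p and q are not roots, the
-- labels of x and y are untouched in both directions.
module Submission where

open import Defs
open import Algebra.Bundles using (CommutativeRing)
open import Data.Bool using (Bool; true; false; not; _∧_; _xor_)
import Data.Bool as Bool
open import Data.Bool.Properties
  using ( xor-∧-commutativeRing; not-involutive; xor-assoc; xor-comm; xor-same
        ; xor-identityʳ; ∧-assoc; ∧-comm; ∧-zeroʳ; ∧-identityʳ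
        ; ∧-distribˡ-xor; ∧-distribʳ-xor )
open import Data.Empty using (⊥-elim)
open import Data.Fin using (Fin; zero; suc; _≟_)
open import Data.List using (filter; length; tabulate)
open import Data.Nat using (ℕ; zero; suc; _*_)
open import Data.Nat.Divisibility using (divides)
open import Data.Product using (_×_; _,_)
open import Function using (_∘_; id)
open import Relation.Binary.PropositionalEquality
  using (_≡_; _≢_; refl; sym; trans; cong; cong₂; module ≡-Reasoning)
open import Relation.Nullary using (yes; no)
open import Relation.Nullary.Decidable using (does)

open CommutativeRing xor-∧-commutativeRing using (semiring)
open import Algebra.Properties.Semiring.Sum semiring
  using (sum; sum-cong-≗; sum-replicate-zero; ∑-distrib-+; *-distribˡ-sum)

open ≡-Reasoning

private
  variable
    n : ℕ

odd : ℕ → Bool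
odd zero    = false
odd (suc k) = not (odd k)

even⇒¬odd : ∀ {k} → Even k → odd k ≡ false
even⇒¬odd (divides q refl) = odd-double q
  where
  odd-double : ∀ q → odd (q * 2) ≡ false
  odd-double zero    = refl
  odd-double (suc q) = trans (not-involutive _) (odd-double q)

¬odd⇒even : ∀ k → odd k ≡ false → Even k
¬odd⇒even zero          _ = divides 0 refl
¬odd⇒even (suc zero)    ()
¬odd⇒even (suc (suc k)) oddk with ¬odd⇒even k (trans (sym (not-involutive (odd k))) oddk)
... | divides q k≡q*2 = divides (suc q) (cong (λ m → suc (suc m)) k≡q*2)

odd-count-tabulate : ∀ {m} (P : Fin n → Bool) (f : Fin m → Fin n) →
  odd (length (filter (λ w → P w Bool.≟ true) (tabulate f))) ≡ sum (P ∘ f)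
odd-count-tabulate {m = zero}  P f = refl
odd-count-tabulate {m = suc m} P f with P (f zero)
... | true  = cong not (odd-count-tabulate P (f ∘ suc))
... | false = odd-count-tabulate P (f ∘ suc)

odd-countV : (P : Fin n → Bool) → odd (countV P) ≡ sum P
odd-countV P = odd-count-tabulate P id

nbrSum : Graph n → (Fin n → Bool) → Fin n → Bool
nbrSum H s v = sum (λ w → adj H v w ∧ s w)

InKernel : Graph n → (Fin n → Bool) → Set
InKernel H s = ∀ v → nbrSum H s v ≡ false

odd-degree : (H : Graph n) (v : Fin n) → odd (degree H v) ≡ nbrSum H (λ _ → true) v
odd-degree H v = trans (odd-countV (adj H v)) (sum-cong-≗ (sym ∘ ∧-identityʳ ∘ adj H v))

Eulerian⇒InKernel-ones : (H : Graph n) → Eulerian H → InKernel H (λ _ → true)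
Eulerian⇒InKernel-ones H eul v = trans (sym (odd-degree H v)) (even⇒¬odd (eul v))

InKernel-ones⇒Eulerian : (H : Graph n) → InKernel H (λ _ → true) → Eulerian H
InKernel-ones⇒Eulerian H k v = ¬odd⇒even _ (trans (odd-degree H v) (k v))

odd-crossCount : (H : Graph n) (s : Fin n → Bool) (v : Fin n) →
  odd (countV (λ w → adj H v w ∧ (s w xor s v))) ≡ nbrSum H s v xor (s v ∧ sum (adj H v))
odd-crossCount H s v = begin
  odd (countV (λ w → adj H v w ∧ (s w xor s v)))
    ≡⟨ odd-countV (λ w → adj H v w ∧ (s w xor s v)) ⟩
  sum (λ w → adj H v w ∧ (s w xor s v))
    ≡⟨ sum-cong-≗ (λ w → ∧-distribˡ-xor (adj H v w) (s w) (s v)) ⟩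
  sum (λ w → (adj H v w ∧ s w) xor (adj H v w ∧ s v))
    ≡⟨ ∑-distrib-+ (λ w → adj H v w ∧ s w) (λ w → adj H v w ∧ s v) ⟩
  nbrSum H s v xor sum (λ w → adj H v w ∧ s v)
    ≡⟨ cong (nbrSum H s v xor_) (sum-cong-≗ (λ w → ∧-comm (adj H v w) (s v))) ⟩
  nbrSum H s v xor sum (λ w → s v ∧ adj H v w)
    ≡⟨ cong (nbrSum H s v xor_) (*-distribˡ-sum (s v) (adj H v)) ⟨
  nbrSum H s v xor (s v ∧ sum (adj H v))
    ∎

odd-crossCount-Eulerian : (H : Graph n) → Eulerian H → (s : Fin n → Bool) (v : Fin n) →
  odd (countV (λ w → adj H v w ∧ (s w xor s v))) ≡ nbrSum H s v
odd-crossCount-Eulerian H eul s v = begin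
  odd (countV (λ w → adj H v w ∧ (s w xor s v))) ≡⟨ odd-crossCount H s v ⟩
  nbrSum H s v xor (s v ∧ sum (adj H v))         ≡⟨ cong (λ d → nbrSum H s v xor (s v ∧ d)) evenRow ⟩
  nbrSum H s v xor (s v ∧ false)                 ≡⟨ cong (nbrSum H s v xor_) (∧-zeroʳ (s v)) ⟩
  nbrSum H s v xor false                         ≡⟨ xor-identityʳ _ ⟩
  nbrSum H s v                                   ∎
  where
  evenRow : sum (adj H v) ≡ false
  evenRow = trans (sym (odd-countV (adj H v))) (even⇒¬odd (eul v))

IsParityCut⇒InKernel : (H : Graph n) → Eulerian H → (s : Fin n → Bool) → IsParityCut H s → InKernel H s
IsParityCut⇒InKernel H eul s cut v = trans (sym (odd-crossCount-Eulerian H eul s v)) (even⇒¬odd (cut v))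

InKernel⇒IsParityCut : (H : Graph n) → Eulerian H → (s : Fin n → Bool) → InKernel H s → IsParityCut H s
InKernel⇒IsParityCut H eul s k v = ¬odd⇒even _ (trans (odd-crossCount-Eulerian H eul s v) (k v))

-- The diagonal exception in gcdsAdj is harmless: at s = t the rank-two term vanishes.
adj-gcds : (G : Graph n) (p q s t : Fin n) →
  adj (gcds G p q) s t ≡ (adj G s t xor (adj G s p ∧ adj G q t)) xor (adj G s q ∧ adj G p t)
adj-gcds G p q s t with s ≟ t
... | yes refl
  rewrite irrefl G s | symm G q s | symm G p s | ∧-comm (adj G s q) (adj G s p) = sym (xor-same (adj G s p ∧ adj G s q))
... | no _ = begin
  ((adj G p s ∧ adj G q t) xor (adj G q s ∧ adj G p t)) xor adj G s t
    ≡⟨ xor-comm _ (adj G s t) ⟩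
  adj G s t xor ((adj G p s ∧ adj G q t) xor (adj G q s ∧ adj G p t))
    ≡⟨ xor-assoc (adj G s t) _ _ ⟨
  (adj G s t xor (adj G p s ∧ adj G q t)) xor (adj G q s ∧ adj G p t)
    ≡⟨ cong₂ (λ a b → (adj G s t xor (a ∧ adj G q t)) xor (b ∧ adj G p t)) (symm G p s) (symm G q s) ⟩
  (adj G s t xor (adj G s p ∧ adj G q t)) xor (adj G s q ∧ adj G p t)
    ∎

nbrSum-gcds : (G : Graph n) (p q : Fin n) (s : Fin n → Bool) (z : Fin n) →
  nbrSum (gcds G p q) s z
    ≡ (nbrSum G s z xor (adj G z p ∧ nbrSum G s q)) xor (adj G z q ∧ nbrSum G s p)
nbrSum-gcds G p q s z = begin
  sum (λ w → adj (gcds G p q) z w ∧ s w)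
    ≡⟨ sum-cong-≗ (λ w → trans (cong (_∧ s w) (adj-gcds G p q z w)) (distribute (adj G z w) (adj G z p) (adj G q w) (adj G z q) (adj G p w) (s w))) ⟩
  sum (λ w → ((adj G z w ∧ s w) xor (adj G z p ∧ (adj G q w ∧ s w))) xor (adj G z q ∧ (adj G p w ∧ s w)))
    ≡⟨ ∑-distrib-+ (λ w → (adj G z w ∧ s w) xor (adj G z p ∧ (adj G q w ∧ s w))) (λ w → adj G z q ∧ (adj G p w ∧ s w)) ⟩
  sum (λ w → (adj G z w ∧ s w) xor (adj G z p ∧ (adj G q w ∧ s w))) xor sum (λ w → adj G z q ∧ (adj G p w ∧ s w))
    ≡⟨ cong₂ _xor_ (∑-distrib-+ (λ w → adj G z w ∧ s w) (λ w → adj G z p ∧ (adj G q w ∧ s w))) (sym (*-distribˡ-sum (adj G z q) (λ w → adj G p w ∧ s w))) ⟩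
  (nbrSum G s z xor sum (λ w → adj G z p ∧ (adj G q w ∧ s w))) xor (adj G z q ∧ nbrSum G s p)
    ≡⟨ cong (λ a → (nbrSum G s z xor a) xor (adj G z q ∧ nbrSum G s p)) (*-distribˡ-sum (adj G z p) (λ w → adj G q w ∧ s w)) ⟨
  (nbrSum G s z xor (adj G z p ∧ nbrSum G s q)) xor (adj G z q ∧ nbrSum G s p)
    ∎
  where
  distribute : ∀ a b c d e x →
    ((a xor (b ∧ c)) xor (d ∧ e)) ∧ x ≡ ((a ∧ x) xor (b ∧ (c ∧ x))) xor (d ∧ (e ∧ x))
  distribute a b c d e x = begin
    ((a xor (b ∧ c)) xor (d ∧ e)) ∧ x         ≡⟨ ∧-distribʳ-xor x (a xor (b ∧ c)) (d ∧ e) ⟩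
    ((a xor (b ∧ c)) ∧ x) xor ((d ∧ e) ∧ x)   ≡⟨ cong₂ _xor_ (∧-distribʳ-xor x a (b ∧ c)) (∧-assoc d e x) ⟩
    ((a ∧ x) xor ((b ∧ c) ∧ x)) xor (d ∧ (e ∧ x))
      ≡⟨ cong (λ y → ((a ∧ x) xor y) xor (d ∧ (e ∧ x))) (∧-assoc b c x) ⟩
    ((a ∧ x) xor (b ∧ (c ∧ x))) xor (d ∧ (e ∧ x)) ∎

gcds-preserves-InKernel : (G : Graph n) (p q : Fin n) (s : Fin n → Bool) →
  InKernel G s → InKernel (gcds G p q) s
gcds-preserves-InKernel G p q s k z
  rewrite nbrSum-gcds G p q s z | k z | k q | k p | ∧-zeroʳ (adj G z p) | ∧-zeroʳ (adj G z q) = refl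

gcds-Eulerian : (G : Graph n) (p q : Fin n) → Eulerian G → Eulerian (gcds G p q)
gcds-Eulerian G p q eul =
  InKernel-ones⇒Eulerian (gcds G p q)
    (gcds-preserves-InKernel G p q (λ _ → true) (Eulerian⇒InKernel-ones G eul))

toggle : (Fin n → Bool) → Fin n → Bool → Fin n → Bool
toggle s u b w = s w xor (b ∧ does (w ≟ u))

toggle-≢ : (s : Fin n → Bool) {u w : Fin n} (b : Bool) → u ≢ w → toggle s u b w ≡ s w
toggle-≢ s {u} {w} b u≢w with w ≟ u
... | yes refl = ⊥-elim (u≢w refl)
... | no _     = trans (cong (s w xor_) (∧-zeroʳ b)) (xor-identityʳ (s w))

sum-∧-indicator : (f : Fin n → Bool) (u : Fin n) → sum (λ w → f w ∧ does (w ≟ u)) ≡ f u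
sum-∧-indicator {suc n} f zero = begin
  (f zero ∧ true) xor sum (λ w → f (suc w) ∧ false)
    ≡⟨ cong₂ _xor_ (∧-identityʳ (f zero)) (sum-cong-≗ (∧-zeroʳ ∘ f ∘ suc)) ⟩
  f zero xor sum {n} (λ _ → false)
    ≡⟨ cong (f zero xor_) (sum-replicate-zero n) ⟩
  f zero xor false
    ≡⟨ xor-identityʳ (f zero) ⟩
  f zero
    ∎
sum-∧-indicator {suc n} f (suc u) =
  trans (cong (_xor sum (λ w → f (suc w) ∧ does (w ≟ u))) (∧-zeroʳ (f zero)))
        (sum-∧-indicator (f ∘ suc) u)

nbrSum-toggle : (H : Graph n) (s : Fin n → Bool) (u : Fin n) (b : Bool) (z : Fin n) →
  nbrSum H (toggle s u b) z ≡ nbrSum H s z xor (adj H z u ∧ b)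
nbrSum-toggle H s u b z = begin
  sum (λ w → adj H z w ∧ (s w xor (b ∧ does (w ≟ u))))
    ≡⟨ sum-cong-≗ (λ w → ∧-distribˡ-xor (adj H z w) (s w) (b ∧ does (w ≟ u))) ⟩
  sum (λ w → (adj H z w ∧ s w) xor (adj H z w ∧ (b ∧ does (w ≟ u))))
    ≡⟨ ∑-distrib-+ (λ w → adj H z w ∧ s w) (λ w → adj H z w ∧ (b ∧ does (w ≟ u))) ⟩
  nbrSum H s z xor sum (λ w → adj H z w ∧ (b ∧ does (w ≟ u)))
    ≡⟨ cong (nbrSum H s z xor_) (sum-cong-≗ (λ w → ∧-assoc (adj H z w) b (does (w ≟ u)))) ⟨
  nbrSum H s z xor sum (λ w → (adj H z w ∧ b) ∧ does (w ≟ u))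
    ≡⟨ cong (nbrSum H s z xor_) (sum-∧-indicator (λ w → adj H z w ∧ b) u) ⟩
  nbrSum H s z xor (adj H z u ∧ b)
    ∎

gcds-InKernel⇒toggled-InKernel : (G : Graph n) (p q : Fin n) (s : Fin n → Bool) →
  InKernel (gcds G p q) s → InKernel G (toggle (toggle s p (nbrSum G s q)) q (nbrSum G s p))
gcds-InKernel⇒toggled-InKernel G p q s k z = begin
  nbrSum G (toggle (toggle s p (nbrSum G s q)) q (nbrSum G s p)) z
    ≡⟨ nbrSum-toggle G _ q _ z ⟩
  nbrSum G (toggle s p (nbrSum G s q)) z xor (adj G z q ∧ nbrSum G s p)
    ≡⟨ cong (_xor (adj G z q ∧ nbrSum G s p)) (nbrSum-toggle G s p _ z) ⟩
  (nbrSum G s z xor (adj G z p ∧ nbrSum G s q)) xor (adj G z q ∧ nbrSum G s p)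
    ≡⟨ nbrSum-gcds G p q s z ⟨
  nbrSum (gcds G p q) s z
    ≡⟨ k z ⟩
  false
    ∎

mainTheorem6 : ∀ {n : ℕ} (G : Graph n) (x y : Fin n) → x ≢ y → Eulerian G →
    (u v : Fin n) → u ≢ x → u ≢ y → v ≢ x → v ≢ y → adj G u v ≡ true →
    (PropertyA (gcds G u v) x y → PropertyA G x y) × (PropertyA G x y → PropertyA (gcds G u v) x y)
mainTheorem6 G x y _ eul u v u≢x u≢y v≢x v≢y _ = fromGcds , toGcds
  where
  G′ = gcds G u v
  eul′ = gcds-Eulerian G u v eul

  toGcds : PropertyA G x y → PropertyA G′ x y
  toGcds (s , cut , sx , sy) =
    s , InKernel⇒IsParityCut G′ eul′ s
          (gcds-preserves-InKernel G u v s (IsParityCut⇒InKernel G eul s cut)) , sx , sy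

  fromGcds : PropertyA G′ x y → PropertyA G x y
  fromGcds (s , cut , sx , sy) =
    t , InKernel⇒IsParityCut G eul t
          (gcds-InKernel⇒toggled-InKernel G u v s (IsParityCut⇒InKernel G′ eul′ s cut))
      , trans (toggle-≢ (toggle s u β) α v≢x) (trans (toggle-≢ s β u≢x) sx)
      , trans (toggle-≢ (toggle s u β) α v≢y) (trans (toggle-≢ s β u≢y) sy)
    where
    α = nbrSum G s u
    β = nbrSum G s v
    t = toggle (toggle s u β) v α
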